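{- Let $M$ be a matroid representable over $\mathbb{F}_2$ satisfying a smooth circuit counting bound, and let $E$ be its set of $m$ elements. Suppose $M$ has no circuit of length at most $\ell$, and let $C$ be a circuit of length $k\in(\ell,1.01\ell]$. Then there is a constant $\kappa$ (depending only on the constant in the smooth circuit counting bound) such that, if $E'$ is obtained by independently keeping each element of $E$ with probability $p$ where $p^{\ell}=m^{ -100\kappa}$, then $C$ is the unique circuit contained in $E'$ with probability at least $\frac{1}{2m^{101\kappa}}$.
   Context: $M=(E,I)$ is representable over $\mathbb{F}_2$ if there are vectors $v_e$ over $\mathbb{F}_2$ with $S$ independent iff $\{v_e:e\in S\}$ is linearly independent. A circuit is a minimal dependent set; its length is its cardinality. For $S\subseteq E$, $M|_S=(S,I\cap2^S)$. $M$ satisfies a smooth circuit counting bound if there is a constant $K$ such that for every $S\subseteq E$, if $M|_S$ has minimum circuit length $\ell'$ then for every positive integer $\alpha$ the number of circuits of length at most $\alpha\ell'$ in $M|_S$ is at most $m^{K\alpha}$. -}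

module Defs where

open import Level using (0ℓ)
open import Data.Bool using (Bool; true; false; _∧_; _∨_; not; _xor_; if_then_else_)
open import Data.Nat using (ℕ; zero; suc; _∸_; _≤ᵇ_; _≤_)
import Data.Nat as ℕ
open import Data.Fin using (Fin)
open import Data.Vec using (Vec; []; _∷_; replicate; zipWith)
open import Data.List using (List; []; _∷_; [_]; _++_; map; filter; length; foldr)
open import Data.Product using (Σ; _×_; ∃)
open import Relation.Binary.PropositionalEquality using (_≡_)
open import Relation.Binary.Structures using (IsTotalOrder)
open import Relation.Nullary using (¬_)
open import Algebra.Bundles using (CommutativeRing)

anyL : {A : Set} → (A → Bool) → List A → Bool
anyL p = foldr (λ x b → p x ∨ b) false

allL : {A : Set} → (A → Bool) → List A → Bool
allL p = foldr (λ x b → p x ∧ b) true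

-- Subsets of the ground set E = Fin m, as characteristic vectors

Subset : ℕ → Set
Subset m = Vec Bool m

allSubsets : (m : ℕ) → List (Subset m)
allSubsets zero    = [ [] ]
allSubsets (suc m) = map (true ∷_) (allSubsets m) ++ map (false ∷_) (allSubsets m)

size : {m : ℕ} → Subset m → ℕ
size []            = 0
size (true  ∷ s)   = suc (size s)
size (false ∷ s)   = size s

_⊆ᵇ_ : {m : ℕ} → Subset m → Subset m → Bool
[]      ⊆ᵇ []      = true
(x ∷ s) ⊆ᵇ (y ∷ t) = (not x ∨ y) ∧ (s ⊆ᵇ t)

_≡ᵇ_ : {m : ℕ} → Subset m → Subset m → Bool
s ≡ᵇ t = (s ⊆ᵇ t) ∧ (t ⊆ᵇ s)

_⊂ᵇ_ : {m : ℕ} → Subset m → Subset m → Bool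
s ⊂ᵇ t = (s ⊆ᵇ t) ∧ not (t ⊆ᵇ s)

∅ : {m : ℕ} → Subset m
∅ = replicate _ false

_∪ᵇ_ : {m : ℕ} → Subset m → Subset m → Subset m
s ∪ᵇ t = zipWith _∨_ s t

_∖ᵇ_ : {m : ℕ} → Subset m → Subset m → Subset m
s ∖ᵇ t = zipWith (λ x y → x ∧ not y) s t

record Matroid (m : ℕ) : Set where
  field
    indep    : Subset m → Bool
    indep-∅  : indep ∅ ≡ true
    indep-⊆  : ∀ S T → (S ⊆ᵇ T) ≡ true → indep T ≡ true → indep S ≡ true
    exchange : ∀ S T → indep S ≡ true → indep T ≡ true → size S ℕ.< size T →
               Σ (Subset m) λ e → (size e ≡ 1) × ((e ⊆ᵇ (T ∖ᵇ S)) ≡ true)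
                                  × (indep (S ∪ᵇ e) ≡ true)

-- Linear independence over 𝔽₂ (Bool with xor as addition)

sumSel : {m d : ℕ} → (Fin m → Vec Bool d) → Subset m → Vec Bool d
sumSel {zero}  v []      = replicate _ false
sumSel {suc m} v (x ∷ t) =
  zipWith _xor_ (if x then v Fin.zero else replicate _ false)
                (sumSel (λ i → v (Fin.suc i)) t)

isZero : {d : ℕ} → Vec Bool d → Bool
isZero []      = true
isZero (x ∷ u) = not x ∧ isZero u

-- {v_e : e ∈ S} is linearly independent over 𝔽₂: no nontrivial linear
-- combination (over 𝔽₂ = a nonempty sub-sum) vanishes
linIndep : {m d : ℕ} → (Fin m → Vec Bool d) → Subset m → Bool
linIndep {m} v S =
  not (anyL (λ T → (T ⊆ᵇ S) ∧ not (T ≡ᵇ ∅) ∧ isZero (sumSel v T)) (allSubsets m))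

RepresentableF2 : {m : ℕ} → Matroid m → Set
RepresentableF2 {m} M =
  Σ ℕ λ d → Σ (Fin m → Vec Bool d) λ v →
    ∀ S → Matroid.indep M S ≡ linIndep v S

isCircuit : {m : ℕ} → Matroid m → Subset m → Bool
isCircuit {m} M C =
  not (Matroid.indep M C) ∧
  allL (λ T → not (T ⊂ᵇ C) ∨ Matroid.indep M T) (allSubsets m)

Circuit : {m : ℕ} → Matroid m → Subset m → Set
Circuit M C = isCircuit M C ≡ true

-- circuits of M|_S are exactly the circuits of M contained in S
CircuitIn : {m : ℕ} → Matroid m → Subset m → Subset m → Set
CircuitIn M S C = Circuit M C × ((C ⊆ᵇ S) ≡ true)

numCircuitsUpTo : {m : ℕ} → Matroid m → Subset m → ℕ → ℕ
numCircuitsUpTo {m} M S L =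
  length (filter (λ C → (isCircuit M C ∧ (C ⊆ᵇ S) ∧ (size C ≤ᵇ L)) Data.Bool.≟ true)
                 (allSubsets m))
  where import Data.Bool

MinCircuitLength : {m : ℕ} → Matroid m → Subset m → ℕ → Set
MinCircuitLength {m} M S ℓ' =
  (Σ (Subset m) λ C → CircuitIn M S C × (size C ≡ ℓ')) ×
  (∀ C → CircuitIn M S C → ℓ' ≤ size C)

SmoothCircuitBound : {m : ℕ} → Matroid m → ℕ → Set
SmoothCircuitBound {m} M K =
  ∀ (S : Subset m) (ℓ' : ℕ) → MinCircuitLength M S ℓ' →
  ∀ (α : ℕ) → 1 ≤ α → numCircuitsUpTo M S (α ℕ.* ℓ') ≤ m ℕ.^ (K ℕ.* α)

NoCircuitUpTo : {m : ℕ} → Matroid m → ℕ → Set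
NoCircuitUpTo {m} M ℓ = ∀ (C : Subset m) → Circuit M C → ¬ (size C ≤ ℓ)

uniqueCircuitIn : {m : ℕ} → Matroid m → Subset m → Subset m → Bool
uniqueCircuitIn {m} M C S =
  (C ⊆ᵇ S) ∧ allL (λ T → not (isCircuit M T ∧ (T ⊆ᵇ S)) ∨ (T ≡ᵇ C)) (allSubsets m)

-- Ordered (commutative) rings: a commutative ring with a total order
-- compatible with + and with strict positivity closed under *.
-- (Stands in for ℝ, which is not available.)

record OrderedCommRing : Set₁ where
  field
    commRing : CommutativeRing 0ℓ 0ℓ
  open CommutativeRing commRing public
  field
    _≤ᴿ_        : Carrier → Carrier → Set
    isTotalOrder : IsTotalOrder _≈_ _≤ᴿ_
    +-mono      : ∀ {a b} c → a ≤ᴿ b → (a + c) ≤ᴿ (b + c)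
    *-pos       : ∀ {a b} → 0# ≤ᴿ a → ¬ (0# ≈ a) → 0# ≤ᴿ b → ¬ (0# ≈ b) →
                  ¬ (0# ≈ (a * b))
    *-nonneg    : ∀ {a b} → 0# ≤ᴿ a → 0# ≤ᴿ b → 0# ≤ᴿ (a * b)
    nontrivial  : ¬ (0# ≈ 1#)

module _ (R : OrderedCommRing) where
  open OrderedCommRing R

  powR : Carrier → ℕ → Carrier
  powR x zero    = 1#
  powR x (suc n) = x * powR x n

  natR : ℕ → Carrier
  natR zero    = 0#
  natR (suc n) = 1# + natR n

  sumR : List Carrier → Carrier
  sumR = foldr _+_ 0#

  -- Pr[ C is the unique circuit in E' ], where E' ⊆ E = Fin m keeps each
  -- element independently with probability p:
  --   Σ_{S ⊆ E, C unique circuit in S} p^|S| (1-p)^(m-|S|)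
  probUniqueCircuit : {m : ℕ} → Matroid m → Subset m → Carrier → Carrier
  probUniqueCircuit {m} M C p =
    sumR (map (λ S → if uniqueCircuitIn M C S
                     then powR p (size S) * powR (1# - p) (m ∸ size S)
                     else 0#)
              (allSubsets m))

{-# OPTIONS --safe #-}
module Submission where

-- Let k = |C| and let D range over the circuits other than C. C is the unique
-- circuit inside E' unless C ∪ D ⊆ E' for some D, so by a union bound
--   Pr[C unique] ≥ p^k (1 - Σ_D p^|D ∖ C|).
-- Over 𝔽₂ the vectors of a circuit sum to zero, so C △ D is dependent. As M has
-- no circuit of length ≤ ℓ, every dependent set has more than ℓ elements; applied
-- to D and C △ D, and with k ≤ 1.01 ℓ, this gives |D| + ℓ ≤ 7 |D ∖ C|. For
-- α = 1 + ⌊|D| / ℓ⌋ and κ = K + 3 the normalisation p^ℓ = m^(-100κ) then yields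
-- p^|D ∖ C| ≤ m^(-3 - Kα), while the smooth bound allows at most m^(Kα) circuits
-- of length ≤ α ℓ. Summing over the m + 1 possible sizes of D gives
-- Σ_D p^|D ∖ C| ≤ (m + 1) / m³ ≤ 1/2, and p^k ≥ m^(-101κ) because k ≤ 1.01 ℓ.
--
-- The ordered ring has no division, so every bound a ≤ m^(-e) is stated as
-- a * m^e ≤ 1.

open import Defs

open import Level using (0ℓ)
open import Data.Bool using (Bool; true; false; _∧_; _∨_; not; _xor_; if_then_else_)
import Data.Bool as Bool
open import Data.Nat as ℕ using (ℕ; zero; suc; NonZero)
import Data.Nat.Properties as ℕ
open import Data.List using (List; []; _∷_; map; _++_; length; filter; upTo)
open import Data.Product using (Σ; _×_; _,_; proj₁; proj₂)
open import Data.Sum using (inj₁; inj₂)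
open import Data.List.Membership.Propositional using (_∈_)
open import Data.List.Relation.Unary.Any using (here; there)
open import Data.List.Membership.Propositional.Properties using (∈-map⁺; ∈-++⁺ˡ; ∈-++⁺ʳ; ∈-upTo⁺; ∈-filter⁺)
open import Data.Vec using (Vec; []; _∷_; replicate; zipWith)
open import Data.Bool.Properties
  using (T-≡; ∨-zeroʳ; ∧-comm; xor-identityˡ; xor-identityʳ; xor-same; xor-∧-commutativeRing)
open import Data.Vec.Properties using (zipWith-identityˡ; zipWith-identityʳ; zipWith-comm)
open import Data.Fin as Fin using (Fin)
open import Algebra.Bundles using (CommutativeRing)
open import Induction.WellFounded using (Acc; acc)
open import Data.Nat.Induction using (<-wellFounded)
open import Data.List.Properties using (length-upTo)
open import Data.Nat.DivMod using (_%_; m≡m%n+[m/n]*n; m%n<n; m/n*n≤m)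
open import Data.Nat.Solver using (module +-*-Solver)
open import Data.List.Extrema ℕ.≤-totalOrder using (argmin; argmin-all; f[argmin]≤f[xs])
open import Data.List.Relation.Unary.All as All using ()
open import Data.List.Relation.Unary.All.Properties using (all-filter)
open import Relation.Binary.Bundles using (Poset)
open import Function.Bundles using (Equivalence)
open import Relation.Binary.Structures using (IsTotalOrder)
open import Relation.Binary.PropositionalEquality as ≡ using (_≡_)

private
  variable
    m d : ℕ

∧-true⁻ : ∀ {a b} → a ∧ b ≡ true → a ≡ true × b ≡ true
∧-true⁻ {true} b≡true = ≡.refl , b≡true

∨-false⁻ : ∀ {a b} → a ∨ b ≡ false → a ≡ false × b ≡ false
∨-false⁻ {false} b≡false = ≡.refl , b≡false

not-true⁻ : ∀ {a} → not a ≡ true → a ≡ false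
not-true⁻ {false} _ = ≡.refl

not-false⁻ : ∀ {a} → not a ≡ false → a ≡ true
not-false⁻ {true} _ = ≡.refl

module _ {A : Set} (P : A → Bool) where

  allL-true⁻ : ∀ {xs} → allL P xs ≡ true → ∀ {x} → x ∈ xs → P x ≡ true
  allL-true⁻ {y ∷ xs} all≡true (here ≡.refl) = proj₁ (∧-true⁻ all≡true)
  allL-true⁻ {y ∷ xs} all≡true (there x∈xs) = allL-true⁻ (proj₂ (∧-true⁻ {P y} all≡true)) x∈xs

  allL-false⁻ : ∀ xs → allL P xs ≡ false → Σ A λ x → P x ≡ false
  allL-false⁻ (x ∷ xs) all≡false with P x in Px
  ... | false = x , Px
  ... | true  = allL-false⁻ xs all≡false

  anyL-true⁺ : ∀ {xs x} → x ∈ xs → P x ≡ true → anyL P xs ≡ true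
  anyL-true⁺ (here ≡.refl) Px rewrite Px = ≡.refl
  anyL-true⁺ {y ∷ xs} (there x∈xs) Px with P y
  ... | true  = ≡.refl
  ... | false = anyL-true⁺ x∈xs Px

  anyL-true⁻ : ∀ xs → anyL P xs ≡ true → Σ A λ x → P x ≡ true
  anyL-true⁻ (x ∷ xs) any≡true with P x in Px
  ... | true  = x , Px
  ... | false = anyL-true⁻ xs any≡true

full : Subset m
full = replicate _ true

infixl 6 _⊕_
_⊕_ : Vec Bool d → Vec Bool d → Vec Bool d
_⊕_ = zipWith _xor_

infixl 7 _∩ᵇ_
_∩ᵇ_ : Subset m → Subset m → Subset m
_∩ᵇ_ = zipWith _∧_

∩ᵇ-comm : (S T : Subset m) → S ∩ᵇ T ≡ T ∩ᵇ S
∩ᵇ-comm = zipWith-comm ∧-comm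

∈-allSubsets : (S : Subset m) → S ∈ allSubsets m
∈-allSubsets {zero}  []          = here ≡.refl
∈-allSubsets {suc m} (true ∷ S)  = ∈-++⁺ˡ (∈-map⁺ (true ∷_) (∈-allSubsets S))
∈-allSubsets {suc m} (false ∷ S) = ∈-++⁺ʳ _ (∈-map⁺ (false ∷_) (∈-allSubsets S))

size≤m : (S : Subset m) → size S ℕ.≤ m
size≤m []          = ℕ.z≤n
size≤m (true ∷ S)  = ℕ.s≤s (size≤m S)
size≤m (false ∷ S) = ℕ.m≤n⇒m≤1+n (size≤m S)

⊆ᵇ-refl : (S : Subset m) → (S ⊆ᵇ S) ≡ true
⊆ᵇ-refl []          = ≡.refl
⊆ᵇ-refl (true ∷ S)  = ⊆ᵇ-refl S
⊆ᵇ-refl (false ∷ S) = ⊆ᵇ-refl S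

⊆ᵇ-full : (S : Subset m) → (S ⊆ᵇ full) ≡ true
⊆ᵇ-full []          = ≡.refl
⊆ᵇ-full (true ∷ S)  = ⊆ᵇ-full S
⊆ᵇ-full (false ∷ S) = ⊆ᵇ-full S

⊆ᵇ-antisym : (S T : Subset m) → (S ⊆ᵇ T) ≡ true → (T ⊆ᵇ S) ≡ true → S ≡ T
⊆ᵇ-antisym []          []          _   _   = ≡.refl
⊆ᵇ-antisym (true ∷ S)  (true ∷ T)  S⊆T T⊆S = ≡.cong (true ∷_) (⊆ᵇ-antisym S T S⊆T T⊆S)
⊆ᵇ-antisym (false ∷ S) (false ∷ T) S⊆T T⊆S = ≡.cong (false ∷_) (⊆ᵇ-antisym S T S⊆T T⊆S)
⊆ᵇ-antisym (true ∷ S)  (false ∷ T) ()  _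
⊆ᵇ-antisym (false ∷ S) (true ∷ T)  _   ()

⊆ᵇ-⊉ᵇ⇒⊂ᵇ : (S T : Subset m) → (S ⊆ᵇ T) ≡ true → (T ⊆ᵇ S) ≡ false → (S ⊂ᵇ T) ≡ true
⊆ᵇ-⊉ᵇ⇒⊂ᵇ S T S⊆T T⊈S rewrite S⊆T | T⊈S = ≡.refl

≡ᵇ-refl : (S : Subset m) → (S ≡ᵇ S) ≡ true
≡ᵇ-refl S rewrite ⊆ᵇ-refl S = ≡.refl

⊆ᵇ⇒size≤ : (S T : Subset m) → (S ⊆ᵇ T) ≡ true → size S ℕ.≤ size T
⊆ᵇ⇒size≤ []          []          _   = ℕ.z≤n
⊆ᵇ⇒size≤ (true ∷ S)  (true ∷ T)  S⊆T = ℕ.s≤s (⊆ᵇ⇒size≤ S T S⊆T)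
⊆ᵇ⇒size≤ (false ∷ S) (true ∷ T)  S⊆T = ℕ.m≤n⇒m≤1+n (⊆ᵇ⇒size≤ S T S⊆T)
⊆ᵇ⇒size≤ (false ∷ S) (false ∷ T) S⊆T = ⊆ᵇ⇒size≤ S T S⊆T

⊂ᵇ⇒size< : (S T : Subset m) → (S ⊂ᵇ T) ≡ true → size S ℕ.< size T
⊂ᵇ⇒size< []          []          ()
⊂ᵇ⇒size< (true ∷ S)  (false ∷ T) ()
⊂ᵇ⇒size< (true ∷ S)  (true ∷ T)  S⊂T = ℕ.s≤s (⊂ᵇ⇒size< S T S⊂T)
⊂ᵇ⇒size< (false ∷ S) (false ∷ T) S⊂T = ⊂ᵇ⇒size< S T S⊂T
⊂ᵇ⇒size< (false ∷ S) (true ∷ T)  S⊂T = ℕ.s≤s (⊆ᵇ⇒size≤ S T (proj₁ (∧-true⁻ S⊂T)))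

∪ᵇ-least : (S T U : Subset m) → (S ⊆ᵇ U) ≡ true → (T ⊆ᵇ U) ≡ true → ((S ∪ᵇ T) ⊆ᵇ U) ≡ true
∪ᵇ-least []      []      []      _   _   = ≡.refl
∪ᵇ-least (a ∷ S) (b ∷ T) (true ∷ U) S⊆U T⊆U
  rewrite ∨-zeroʳ (not a) | ∨-zeroʳ (not b) | ∨-zeroʳ (not (a ∨ b)) = ∪ᵇ-least S T U S⊆U T⊆U
∪ᵇ-least (false ∷ S) (false ∷ T) (false ∷ U) S⊆U T⊆U = ∪ᵇ-least S T U S⊆U T⊆U

⊕⊆ᵇ∅⇒≡ : (S T : Subset m) → ((S ⊕ T) ⊆ᵇ ∅) ≡ true → S ≡ T
⊕⊆ᵇ∅⇒≡ []          []          _ = ≡.refl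
⊕⊆ᵇ∅⇒≡ (true ∷ S)  (true ∷ T)  S⊕T⊆∅ = ≡.cong (true ∷_) (⊕⊆ᵇ∅⇒≡ S T S⊕T⊆∅)
⊕⊆ᵇ∅⇒≡ (false ∷ S) (false ∷ T) S⊕T⊆∅ = ≡.cong (false ∷_) (⊕⊆ᵇ∅⇒≡ S T S⊕T⊆∅)

≢ᵇ⇒⊕≢ᵇ∅ : (S T : Subset m) → (T ≡ᵇ S) ≡ false → ((S ⊕ T) ≡ᵇ ∅) ≡ false
≢ᵇ⇒⊕≢ᵇ∅ S T T≢S with (S ⊕ T) ≡ᵇ ∅ in S⊕T≡∅
... | false = ≡.refl
... | true with ⊕⊆ᵇ∅⇒≡ S T (proj₁ (∧-true⁻ S⊕T≡∅))
... | ≡.refl with ≡.trans (≡.sym (≡ᵇ-refl S)) T≢S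
... | ()

size-∖ᵇ-∩ᵇ : (S T : Subset m) → size S ≡ size (S ∖ᵇ T) ℕ.+ size (S ∩ᵇ T)
size-∖ᵇ-∩ᵇ []          []          = ≡.refl
size-∖ᵇ-∩ᵇ (true ∷ S)  (true ∷ T)  = ≡.trans (≡.cong suc (size-∖ᵇ-∩ᵇ S T)) (≡.sym (ℕ.+-suc _ _))
size-∖ᵇ-∩ᵇ (true ∷ S)  (false ∷ T) = ≡.cong suc (size-∖ᵇ-∩ᵇ S T)
size-∖ᵇ-∩ᵇ (false ∷ S) (_ ∷ T)     = size-∖ᵇ-∩ᵇ S T

size-⊕ : (S T : Subset m) → size (S ⊕ T) ≡ size (S ∖ᵇ T) ℕ.+ size (T ∖ᵇ S)
size-⊕ []          []          = ≡.refl
size-⊕ (true ∷ S)  (true ∷ T)  = size-⊕ S T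
size-⊕ (true ∷ S)  (false ∷ T) = ≡.cong suc (size-⊕ S T)
size-⊕ (false ∷ S) (true ∷ T)  = ≡.trans (≡.cong suc (size-⊕ S T)) (≡.sym (ℕ.+-suc _ _))
size-⊕ (false ∷ S) (false ∷ T) = size-⊕ S T

size-∪ᵇ : (S T : Subset m) → size (S ∪ᵇ T) ≡ size S ℕ.+ size (T ∖ᵇ S)
size-∪ᵇ []          []          = ≡.refl
size-∪ᵇ (true ∷ S)  (true ∷ T)  = ≡.cong suc (size-∪ᵇ S T)
size-∪ᵇ (true ∷ S)  (false ∷ T) = ≡.cong suc (size-∪ᵇ S T)
size-∪ᵇ (false ∷ S) (true ∷ T)  = ≡.trans (≡.cong suc (size-∪ᵇ S T)) (≡.sym (ℕ.+-suc _ _))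
size-∪ᵇ (false ∷ S) (false ∷ T) = size-∪ᵇ S T

⊕-identityˡ : (u : Vec Bool d) → ∅ ⊕ u ≡ u
⊕-identityˡ = zipWith-identityˡ xor-identityˡ

⊕-identityʳ : (u : Vec Bool d) → u ⊕ ∅ ≡ u
⊕-identityʳ = zipWith-identityʳ xor-identityʳ

⊕-self : (u : Vec Bool d) → u ⊕ u ≡ ∅
⊕-self []      = ≡.refl
⊕-self (x ∷ u) = ≡.cong₂ _∷_ (xor-same x) (⊕-self u)

⊕-interchange : (t u w z : Vec Bool d) → (t ⊕ u) ⊕ (w ⊕ z) ≡ (t ⊕ w) ⊕ (u ⊕ z)
⊕-interchange []      []      []      []      = ≡.refl
⊕-interchange (a ∷ t) (b ∷ u) (c ∷ w) (e ∷ z) =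
  ≡.cong₂ _∷_ (xor-interchange a b c e) (⊕-interchange t u w z)
  where
  open import Algebra.Properties.CommutativeSemigroup
    (CommutativeRing.+-commutativeSemigroup xor-∧-commutativeRing)
    using () renaming (interchange to xor-interchange)

if-xor-distrib-⊕ : ∀ a b (u : Vec Bool d) →
  (if a xor b then u else ∅) ≡ (if a then u else ∅) ⊕ (if b then u else ∅)
if-xor-distrib-⊕ true  true  u = ≡.sym (⊕-self u)
if-xor-distrib-⊕ true  false u = ≡.sym (⊕-identityʳ u)
if-xor-distrib-⊕ false true  u = ≡.sym (⊕-identityˡ u)
if-xor-distrib-⊕ false false u = ≡.sym (⊕-self ∅)

sumSel-⊕ : (v : Fin m → Vec Bool d) (S T : Subset m) → sumSel v (S ⊕ T) ≡ sumSel v S ⊕ sumSel v T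
sumSel-⊕ {zero}  v []      []      = ≡.sym (⊕-self ∅)
sumSel-⊕ {suc m} v (a ∷ S) (b ∷ T) = begin
  (if a xor b then v₀ else ∅) ⊕ sumSel v₊ (S ⊕ T)
    ≡⟨ ≡.cong₂ _⊕_ (if-xor-distrib-⊕ a b v₀) (sumSel-⊕ v₊ S T) ⟩
  ((if a then v₀ else ∅) ⊕ (if b then v₀ else ∅)) ⊕ (sumSel v₊ S ⊕ sumSel v₊ T)
    ≡⟨ ⊕-interchange _ _ _ _ ⟩
  ((if a then v₀ else ∅) ⊕ sumSel v₊ S) ⊕ ((if b then v₀ else ∅) ⊕ sumSel v₊ T) ∎
  where
  open ≡.≡-Reasoning
  v₀ = v Fin.zero
  v₊ = λ i → v (Fin.suc i)

isZero⇒≡∅ : (u : Vec Bool d) → isZero u ≡ true → u ≡ ∅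
isZero⇒≡∅ []          _      = ≡.refl
isZero⇒≡∅ (false ∷ u) u≡0    = ≡.cong (false ∷_) (isZero⇒≡∅ u u≡0)

isZero-∅ : ∀ d → isZero (∅ {d}) ≡ true
isZero-∅ zero    = ≡.refl
isZero-∅ (suc d) = isZero-∅ d

isZero-sumSel-⊕ : (v : Fin m → Vec Bool d) (S T : Subset m) →
  isZero (sumSel v S) ≡ true → isZero (sumSel v T) ≡ true → isZero (sumSel v (S ⊕ T)) ≡ true
isZero-sumSel-⊕ {d = d} v S T ΣS≡0 ΣT≡0 = ≡.subst (λ u → isZero u ≡ true) (≡.sym ΣS⊕T≡∅) (isZero-∅ d)
  where
  ΣS⊕T≡∅ : sumSel v (S ⊕ T) ≡ ∅
  ΣS⊕T≡∅ = ≡.trans (sumSel-⊕ v S T)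
             (≡.trans (≡.cong₂ _⊕_ (isZero⇒≡∅ _ ΣS≡0) (isZero⇒≡∅ _ ΣT≡0)) (⊕-self ∅))

module CircuitProperties (M : Matroid m) where

  open Matroid M

  properSubsetsIndep : Subset m → Bool
  properSubsetsIndep C = allL (λ T → not (T ⊂ᵇ C) ∨ indep T) (allSubsets m)

  circuit⇒dependent : ∀ {C} → Circuit M C → indep C ≡ false
  circuit⇒dependent {C} C-circ = not-true⁻ (proj₁ (∧-true⁻ C-circ))

  circuit-⊂ᵇ⇒indep : ∀ {C} T → Circuit M C → (T ⊂ᵇ C) ≡ true → indep T ≡ true
  circuit-⊂ᵇ⇒indep {C} T C-circ T⊂C
    with allL-true⁻ _ (proj₂ (∧-true⁻ {not (indep C)} C-circ)) (∈-allSubsets T)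
  ... | T⊄C∨T-indep rewrite T⊂C = T⊄C∨T-indep

  noCircuitUpTo⇒dependent-size> : ∀ {ℓ} → NoCircuitUpTo M ℓ → ∀ S → indep S ≡ false → ℓ ℕ.< size S
  noCircuitUpTo⇒dependent-size> {ℓ} noShort S = go S (<-wellFounded (size S))
    where
    go : ∀ S → Acc ℕ._<_ (size S) → indep S ≡ false → ℓ ℕ.< size S
    go S (acc smaller) S-dep with isCircuit M S in S-circ
    ... | true  = ℕ.≰⇒> (noShort S S-circ)
    ... | false
      with allL-false⁻ _ (allSubsets m) (≡.subst (λ b → not b ∧ properSubsetsIndep S ≡ false) S-dep S-circ)
    ... | T , T-witness with ∨-false⁻ {not (T ⊂ᵇ S)} T-witness
    ... | T⊂S , T-dep = ℕ.<-trans (go T (smaller T<S) T-dep) T<S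
      where
      T<S = ⊂ᵇ⇒size< T S (not-false⁻ T⊂S)

module RepresentationProperties (M : Matroid m) (v : Fin m → Vec Bool d)
                                (rep : ∀ S → Matroid.indep M S ≡ linIndep v S) where

  open Matroid M
  open CircuitProperties M

  zeroSum⇒dependent : ∀ T → (T ≡ᵇ ∅) ≡ false → isZero (sumSel v T) ≡ true → indep T ≡ false
  zeroSum⇒dependent T T≢∅ ΣT≡0 =
    ≡.trans (rep T) (≡.cong not (anyL-true⁺ _ (∈-allSubsets T) T-witness))
    where
    T-witness : ((T ⊆ᵇ T) ∧ not (T ≡ᵇ ∅) ∧ isZero (sumSel v T)) ≡ true
    T-witness rewrite ⊆ᵇ-refl T | T≢∅ | ΣT≡0 = ≡.refl

  circuit-zeroSubset≡ : ∀ {C} T → Circuit M C → (T ⊆ᵇ C) ≡ true → (T ≡ᵇ ∅) ≡ false →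
                        isZero (sumSel v T) ≡ true → T ≡ C
  circuit-zeroSubset≡ {C} T C-circ T⊆C T≢∅ ΣT≡0 with C ⊆ᵇ T in C⊆T
  ... | true  = ⊆ᵇ-antisym T C T⊆C C⊆T
  ... | false with ≡.trans (≡.sym (circuit-⊂ᵇ⇒indep T C-circ (⊆ᵇ-⊉ᵇ⇒⊂ᵇ T C T⊆C C⊆T)))
                           (zeroSum⇒dependent T T≢∅ ΣT≡0)
  ... | ()

  circuit⇒zeroSum : ∀ {C} → Circuit M C → isZero (sumSel v C) ≡ true
  circuit⇒zeroSum {C} C-circ
    with anyL-true⁻ _ (allSubsets m) (not-false⁻ (≡.trans (≡.sym (rep C)) (circuit⇒dependent C-circ)))
  ... | T , T-witness with ∧-true⁻ {T ⊆ᵇ C} T-witness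
  ... | T⊆C , T-rest with ∧-true⁻ {not (T ≡ᵇ ∅)} T-rest
  ... | T≢∅ , ΣT≡0 with circuit-zeroSubset≡ T C-circ T⊆C (not-true⁻ T≢∅) ΣT≡0
  ... | ≡.refl = ΣT≡0

  circuit-⊕-dependent : ∀ {C D} → Circuit M C → Circuit M D → (D ≡ᵇ C) ≡ false → indep (C ⊕ D) ≡ false
  circuit-⊕-dependent {C} {D} C-circ D-circ D≢C =
    zeroSum⇒dependent (C ⊕ D) (≢ᵇ⇒⊕≢ᵇ∅ C D D≢C)
      (isZero-sumSel-⊕ v C D (circuit⇒zeroSum C-circ) (circuit⇒zeroSum D-circ))

module _ where

  open import Data.Nat using (_+_; _*_; _^_; _≤_; _<_; _/_)
  open ℕ.≤-Reasoning
  open +-*-Solver using (solve; _:=_; _:+_; _:*_; con)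

  -- i = |C ∩ D|, j = |D ∖ C|, c = |C ∖ D|: adding ℓ < |D| and ℓ < |C △ D| gives
  -- 2ℓ < 2j + k, so j > 0.49 ℓ, while i ≤ k ≤ 1.01 ℓ.
  overlap-bound : ∀ ℓ i j c → ℓ < j + i → ℓ < c + j → 100 * (c + i) ≤ 101 * ℓ →
                  j + i + ℓ ≤ 7 * j
  overlap-bound ℓ i j c ℓ<j+i ℓ<c+j tight =
    ≡.subst (_≤ 7 * j) (≡.sym (ℕ.+-assoc j i ℓ)) (ℕ.+-monoʳ-≤ j i+ℓ≤6j)
    where
    200+99ℓ≤200j : 200 + 99 * ℓ ≤ 200 * j
    200+99ℓ≤200j = ℕ.+-cancelʳ-≤ (101 * ℓ) _ _ (begin
      200 + 99 * ℓ + 101 * ℓ     ≡⟨ solve 1 (λ l → con 200 :+ con 99 :* l :+ con 101 :* l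
                                                   := con 100 :* ((con 1 :+ l) :+ (con 1 :+ l))) ≡.refl ℓ ⟩
      100 * (suc ℓ + suc ℓ)      ≤⟨ ℕ.*-monoʳ-≤ 100 (ℕ.+-mono-≤ ℓ<j+i ℓ<c+j) ⟩
      100 * ((j + i) + (c + j))  ≡⟨ solve 3 (λ j i c → con 100 :* ((j :+ i) :+ (c :+ j))
                                                   := con 200 :* j :+ con 100 :* (c :+ i)) ≡.refl j i c ⟩
      200 * j + 100 * (c + i)    ≤⟨ ℕ.+-monoʳ-≤ (200 * j) tight ⟩
      200 * j + 101 * ℓ          ∎)
    i+ℓ≤6j : i + ℓ ≤ 6 * j
    i+ℓ≤6j = ℕ.*-cancelˡ-≤ 100 (begin
      100 * (i + ℓ)              ≤⟨ ℕ.*-monoʳ-≤ 100 (ℕ.+-monoˡ-≤ ℓ (ℕ.m≤n+m i c)) ⟩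
      100 * (c + i + ℓ)          ≡⟨ ℕ.*-distribˡ-+ 100 (c + i) ℓ ⟩
      100 * (c + i) + 100 * ℓ    ≤⟨ ℕ.+-monoˡ-≤ (100 * ℓ) tight ⟩
      101 * ℓ + 100 * ℓ          ≤⟨ ℕ.+-monoˡ-≤ (100 * ℓ) (ℕ.*-monoˡ-≤ ℓ (ℕ.m≤m+n 101 96)) ⟩
      197 * ℓ + 100 * ℓ          ≡⟨ solve 1 (λ l → con 197 :* l :+ con 100 :* l := con 3 :* (con 99 :* l)) ≡.refl ℓ ⟩
      3 * (99 * ℓ)               ≤⟨ ℕ.*-monoʳ-≤ 3 (ℕ.≤-trans (ℕ.m≤n+m (99 * ℓ) 200) 200+99ℓ≤200j) ⟩
      3 * (200 * j)              ≡⟨ solve 1 (λ j → con 3 :* (con 200 :* j) := con 100 :* (con 6 :* j)) ≡.refl j ⟩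
      100 * (6 * j)              ∎)

  ℓ<k∧100k≤101ℓ⇒NonZero : ∀ {ℓ k} → ℓ < k → 100 * k ≤ 101 * ℓ → NonZero ℓ
  ℓ<k∧100k≤101ℓ⇒NonZero {zero}  {suc k} _ ()
  ℓ<k∧100k≤101ℓ⇒NonZero {suc ℓ} _       _ = _

  *-scale-≤ : ∀ a b c e κ → a * b ≤ c * e → a * κ * b ≤ c * κ * e
  *-scale-≤ a b c e κ ab≤ce = begin
    a * κ * b    ≡⟨ solve 3 (λ a κ b → a :* κ :* b := κ :* (a :* b)) ≡.refl a κ b ⟩
    κ * (a * b)  ≤⟨ ℕ.*-monoʳ-≤ κ ab≤ce ⟩
    κ * (c * e)  ≡⟨ solve 3 (λ c κ e → κ :* (c :* e) := c :* κ :* e) ≡.refl c κ e ⟩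
    c * κ * e    ∎

  s<[1+s/ℓ]*ℓ : ∀ s ℓ .{{_ : NonZero ℓ}} → s < suc (s / ℓ) * ℓ
  s<[1+s/ℓ]*ℓ s ℓ = begin-strict
    s                  ≡⟨ m≡m%n+[m/n]*n s ℓ ⟩
    s % ℓ + s / ℓ * ℓ  <⟨ ℕ.+-monoˡ-< (s / ℓ * ℓ) (m%n<n s ℓ) ⟩
    ℓ + s / ℓ * ℓ      ∎

  exponent-bound : ∀ K ℓ .{{_ : NonZero ℓ}} s j → s + ℓ ≤ 7 * j →
                   (3 + K * suc (s / ℓ)) * ℓ ≤ 100 * (K + 3) * j
  exponent-bound K ℓ s j s+ℓ≤7j = begin
    (3 + K * suc q) * ℓ      ≡⟨ solve 3 (λ K q ℓ → (con 3 :+ K :* (con 1 :+ q)) :* ℓ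
                                             := con 3 :* ℓ :+ K :* (ℓ :+ q :* ℓ)) ≡.refl K q ℓ ⟩
    3 * ℓ + K * (ℓ + q * ℓ)  ≤⟨ ℕ.+-mono-≤ (ℕ.*-monoʳ-≤ 3 (ℕ.m≤n+m ℓ s))
                                           (ℕ.*-monoʳ-≤ K (ℕ.≤-trans (ℕ.+-monoʳ-≤ ℓ (m/n*n≤m s ℓ))
                                                                       (ℕ.≤-reflexive (ℕ.+-comm ℓ s)))) ⟩
    3 * (s + ℓ) + K * (s + ℓ) ≡⟨ solve 2 (λ K x → con 3 :* x :+ K :* x := (K :+ con 3) :* x) ≡.refl K (s + ℓ) ⟩
    (K + 3) * (s + ℓ)        ≤⟨ ℕ.*-monoʳ-≤ (K + 3) s+ℓ≤7j ⟩
    (K + 3) * (7 * j)        ≤⟨ ℕ.m≤m+n _ (93 * ((K + 3) * j)) ⟩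
    (K + 3) * (7 * j) + 93 * ((K + 3) * j)
                             ≡⟨ solve 2 (λ K j → (K :+ con 3) :* (con 7 :* j) :+ con 93 :* ((K :+ con 3) :* j)
                                             := con 100 :* (K :+ con 3) :* j) ≡.refl K j ⟩
    100 * (K + 3) * j        ∎
    where
    q = s / ℓ

  2≤m⇒2*[1+m]≤m^3 : ∀ {m} → 2 ≤ m → 2 * suc m ≤ m ^ 3
  2≤m⇒2*[1+m]≤m^3 {m@(suc (suc n))} (ℕ.s≤s (ℕ.s≤s ℕ.z≤n)) = begin
    2 * suc m                              ≤⟨ ℕ.m≤m+n (2 * suc m) (2 + 6 * n + 2 * (n * n)) ⟩
    2 * suc m + (2 + 6 * n + 2 * (n * n))  ≡⟨ solve 1 (λ n → con 2 :* (con 3 :+ n)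
                                                               :+ (con 2 :+ con 6 :* n :+ con 2 :* (n :* n))
                                                          := (con 2 :+ n) :* ((con 2 :+ n) :* con 2)) ≡.refl n ⟩
    m * (m * 2)                            ≤⟨ ℕ.*-monoʳ-≤ m (ℕ.*-monoʳ-≤ m (ℕ.s≤s (ℕ.s≤s ℕ.z≤n))) ⟩
    m * (m * (m * 1))                      ∎

module OrderedCommRingProperties (R : OrderedCommRing) where

  open OrderedCommRing R
  open IsTotalOrder isTotalOrder public using (total)
    renaming (refl to ≤-refl; trans to ≤-trans; reflexive to ≤-reflexive)
  open import Algebra.Properties.Ring ring using (-1*x≈-x; -‿involutive; [y-z]x≈yx-zx)
  open import Algebra.Properties.CommutativeSemiring.Exp commutativeSemiring public
    using (_^_; ^-congˡ; ^-congʳ; ^-homo-*; ^-assocʳ; ^-distrib-*)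

  infix 4 _≤_
  _≤_ : Carrier → Carrier → Set
  _≤_ = _≤ᴿ_

  poset : Poset 0ℓ 0ℓ 0ℓ
  poset = record { isPartialOrder = IsTotalOrder.isPartialOrder isTotalOrder }

  open import Relation.Binary.Reasoning.PartialOrder poset
  open import Algebra.Properties.CommutativeSemigroup *-commutativeSemigroup public
    using () renaming (xy∙z≈xz∙y to *-xy∙z≈xz∙y; x∙yz≈y∙xz to *-x∙yz≈y∙xz)

  private variable
    a b c e x y : Carrier

  +-monoʳ-≤ : ∀ c → a ≤ b → c + a ≤ c + b
  +-monoʳ-≤ {a} {b} c a≤b = begin
    c + a ≈⟨ +-comm c a ⟩
    a + c ≤⟨ +-mono c a≤b ⟩
    b + c ≈⟨ +-comm b c ⟩
    c + b ∎

  +-mono-≤ : a ≤ b → c ≤ e → a + c ≤ b + e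
  +-mono-≤ {a} {b} {c} {e} a≤b c≤e = ≤-trans (+-mono c a≤b) (+-monoʳ-≤ b c≤e)

  +-cancelʳ-≤ : ∀ c → a + c ≤ b + c → a ≤ b
  +-cancelʳ-≤ {a} {b} c a+c≤b+c = begin
    a             ≈⟨ cancel a ⟨
    a + c + - c   ≤⟨ +-mono (- c) a+c≤b+c ⟩
    b + c + - c   ≈⟨ cancel b ⟩
    b             ∎
    where
    cancel : ∀ x → x + c + - c ≈ x
    cancel x = trans (+-assoc x c (- c)) (trans (+-congˡ (-‿inverseʳ c)) (+-identityʳ x))

  x≤y⇒0≤y-x : x ≤ y → 0# ≤ y - x
  x≤y⇒0≤y-x {x} {y} x≤y = begin
    0#     ≈⟨ -‿inverseʳ x ⟨
    x - x  ≤⟨ +-mono (- x) x≤y ⟩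
    y - x  ∎

  0≤y-x⇒x≤y : 0# ≤ y - x → x ≤ y
  0≤y-x⇒x≤y {y} {x} 0≤y-x = +-cancelʳ-≤ (- x) (begin
    x - x  ≈⟨ -‿inverseʳ x ⟩
    0#     ≤⟨ 0≤y-x ⟩
    y - x  ∎)

  0≤1 : 0# ≤ 1#
  0≤1 with total 0# 1#
  ... | inj₁ 0≤1 = 0≤1
  ... | inj₂ 1≤0 = begin
    0#          ≤⟨ *-nonneg 0≤-1 0≤-1 ⟩
    - 1# * - 1# ≈⟨ -1*x≈-x (- 1#) ⟩
    - - 1#      ≈⟨ -‿involutive 1# ⟩
    1#          ∎
    where
    0≤-1 : 0# ≤ - 1#
    0≤-1 = ≤-trans (x≤y⇒0≤y-x 1≤0) (≤-reflexive (+-identityˡ (- 1#)))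

  *-monoʳ-≤-nonNeg : 0# ≤ c → a ≤ b → a * c ≤ b * c
  *-monoʳ-≤-nonNeg {c} {a} {b} 0≤c a≤b = 0≤y-x⇒x≤y (begin
    0#            ≤⟨ *-nonneg (x≤y⇒0≤y-x a≤b) 0≤c ⟩
    (b - a) * c   ≈⟨ [y-z]x≈yx-zx c b a ⟩
    b * c - a * c ∎)

  *-monoˡ-≤-nonNeg : 0# ≤ c → a ≤ b → c * a ≤ c * b
  *-monoˡ-≤-nonNeg {c} {a} {b} 0≤c a≤b = begin
    c * a ≈⟨ *-comm c a ⟩
    a * c ≤⟨ *-monoʳ-≤-nonNeg 0≤c a≤b ⟩
    b * c ≈⟨ *-comm b c ⟩
    c * b ∎

  *-mono-≤-nonNeg : 0# ≤ a → 0# ≤ c → a ≤ b → c ≤ e → a * c ≤ b * e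
  *-mono-≤-nonNeg 0≤a 0≤c a≤b c≤e =
    ≤-trans (*-monoʳ-≤-nonNeg 0≤c a≤b) (*-monoˡ-≤-nonNeg (≤-trans 0≤a a≤b) c≤e)

  x≤y⇒x-y≤0 : x ≤ y → x - y ≤ 0#
  x≤y⇒x-y≤0 {x} {y} x≤y = ≤-trans (+-mono (- y) x≤y) (≤-reflexive (-‿inverseʳ y))

  x-y≤0⇒x≤y : x - y ≤ 0# → x ≤ y
  x-y≤0⇒x≤y {x} {y} x-y≤0 = +-cancelʳ-≤ (- y) (≤-trans x-y≤0 (≤-reflexive (sym (-‿inverseʳ y))))

  *-cancelʳ-≤ : 1# ≤ c → a * c ≤ b * c → a ≤ b
  *-cancelʳ-≤ {c} {a} {b} 1≤c ac≤bc with total a b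
  ... | inj₁ a≤b = a≤b
  ... | inj₂ b≤a = x-y≤0⇒x≤y (begin
    a - b           ≈⟨ *-identityʳ (a - b) ⟨
    (a - b) * 1#    ≤⟨ *-monoˡ-≤-nonNeg (x≤y⇒0≤y-x b≤a) 1≤c ⟩
    (a - b) * c     ≈⟨ [y-z]x≈yx-zx c a b ⟩
    a * c - b * c   ≤⟨ x≤y⇒x-y≤0 ac≤bc ⟩
    0#              ∎)

  powR≡^ : ∀ x n → powR R x n ≡ x ^ n
  powR≡^ x zero    = ≡.refl
  powR≡^ x (suc n) = ≡.cong (x *_) (powR≡^ x n)

  x^n-nonNeg : ∀ n → 0# ≤ x → 0# ≤ x ^ n
  x^n-nonNeg zero    0≤x = 0≤1
  x^n-nonNeg (suc n) 0≤x = *-nonneg 0≤x (x^n-nonNeg n 0≤x)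

  x≤1⇒x^n≤1 : ∀ n → 0# ≤ x → x ≤ 1# → x ^ n ≤ 1#
  x≤1⇒x^n≤1 zero    0≤x x≤1 = ≤-refl
  x≤1⇒x^n≤1 {x} (suc n) 0≤x x≤1 = begin
    x * x ^ n ≤⟨ *-mono-≤-nonNeg 0≤x (x^n-nonNeg n 0≤x) x≤1 (x≤1⇒x^n≤1 n 0≤x x≤1) ⟩
    1# * 1#   ≈⟨ *-identityˡ 1# ⟩
    1#        ∎

  1≤x⇒1≤x^n : ∀ n → 1# ≤ x → 1# ≤ x ^ n
  1≤x⇒1≤x^n zero    1≤x = ≤-refl
  1≤x⇒1≤x^n {x} (suc n) 1≤x = begin
    1#        ≈⟨ *-identityˡ 1# ⟨
    1# * 1#   ≤⟨ *-mono-≤-nonNeg 0≤1 0≤1 1≤x (1≤x⇒1≤x^n n 1≤x) ⟩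
    x * x ^ n ∎

  ^-monoʳ-≤ : 1# ≤ x → ∀ {m n} → m ℕ.≤ n → x ^ m ≤ x ^ n
  ^-monoʳ-≤ {x} 1≤x {m} {n} m≤n = begin
    x ^ m                 ≈⟨ *-identityʳ (x ^ m) ⟨
    x ^ m * 1#            ≤⟨ *-monoˡ-≤-nonNeg (x^n-nonNeg m (≤-trans 0≤1 1≤x)) (1≤x⇒1≤x^n (n ℕ.∸ m) 1≤x) ⟩
    x ^ m * x ^ (n ℕ.∸ m) ≈⟨ ^-homo-* x m (n ℕ.∸ m) ⟨
    x ^ (m ℕ.+ (n ℕ.∸ m)) ≡⟨ ≡.cong (x ^_) (ℕ.m+[n∸m]≡n m≤n) ⟩
    x ^ n                 ∎

  x^n≤1⇒x≤1 : ∀ n .{{_ : NonZero n}} → 0# ≤ x → x ^ n ≤ 1# → x ≤ 1#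
  x^n≤1⇒x≤1 {x} (suc n) 0≤x x^n≤1 with total x 1#
  ... | inj₁ x≤1 = x≤1
  ... | inj₂ 1≤x = begin
    x         ≈⟨ *-identityʳ x ⟨
    x * 1#    ≤⟨ *-monoˡ-≤-nonNeg 0≤x (1≤x⇒1≤x^n n 1≤x) ⟩
    x * x ^ n ≤⟨ x^n≤1 ⟩
    1#        ∎

  1≤x^n⇒1≤x : ∀ n .{{_ : NonZero n}} → 0# ≤ x → 1# ≤ x ^ n → 1# ≤ x
  1≤x^n⇒1≤x {x} (suc n) 0≤x 1≤x^n with total x 1#
  ... | inj₂ 1≤x = 1≤x
  ... | inj₁ x≤1 = begin
    1#        ≤⟨ 1≤x^n ⟩
    x * x ^ n ≤⟨ *-monoˡ-≤-nonNeg 0≤x (x≤1⇒x^n≤1 n 0≤x x≤1) ⟩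
    x * 1#    ≈⟨ *-identityʳ x ⟩
    x         ∎

  1^n≈1 : ∀ n → 1# ^ n ≈ 1#
  1^n≈1 zero    = refl
  1^n≈1 (suc n) = trans (*-identityˡ (1# ^ n)) (1^n≈1 n)

  open import Algebra.Properties.Semiring.Mult semiring renaming (_×_ to _×ᵣ_) using (×1-homo-*)

  natR≡×1 : ∀ n → natR R n ≡ n ×ᵣ 1#
  natR≡×1 zero    = ≡.refl
  natR≡×1 (suc n) = ≡.cong (1# +_) (natR≡×1 n)

  natR-nonNeg : ∀ n → 0# ≤ natR R n
  natR-nonNeg zero    = ≤-refl
  natR-nonNeg (suc n) = begin
    0#             ≈⟨ +-identityˡ 0# ⟨
    0# + 0#        ≤⟨ +-mono-≤ 0≤1 (natR-nonNeg n) ⟩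
    1# + natR R n  ∎

  natR-mono-≤ : ∀ {m n} → m ℕ.≤ n → natR R m ≤ natR R n
  natR-mono-≤ {n = n} ℕ.z≤n = natR-nonNeg n
  natR-mono-≤ (ℕ.s≤s m≤n)   = +-monoʳ-≤ 1# (natR-mono-≤ m≤n)

  natR-homo-* : ∀ m n → natR R (m ℕ.* n) ≈ natR R m * natR R n
  natR-homo-* m n
    rewrite natR≡×1 (m ℕ.* n) | natR≡×1 m | natR≡×1 n = ×1-homo-* m n

  natR-2*x≈x+x : ∀ x → natR R 2 * x ≈ x + x
  natR-2*x≈x+x x = begin-equality
    (1# + (1# + 0#)) * x  ≈⟨ *-congʳ (+-congˡ (+-identityʳ 1#)) ⟩
    (1# + 1#) * x         ≈⟨ distribʳ x 1# 1# ⟩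
    1# * x + 1# * x       ≈⟨ +-cong (*-identityˡ x) (*-identityˡ x) ⟩
    x + x                 ∎

  natR-homo-^ : ∀ m n → natR R (m ℕ.^ n) ≈ natR R m ^ n
  natR-homo-^ m zero    = +-identityʳ 1#
  natR-homo-^ m (suc n) = trans (natR-homo-* m (m ℕ.^ n)) (*-congˡ (natR-homo-^ m n))

  if-nonNeg : ∀ b {x} → 0# ≤ x → 0# ≤ (if b then x else 0#)
  if-nonNeg true  0≤x = 0≤x
  if-nonNeg false 0≤x = ≤-refl

  ∑ : {A : Set} → List A → (A → Carrier) → Carrier
  ∑ xs f = sumR R (map f xs)

  syntax ∑ xs (λ x → e) = ∑[ x ← xs ] e

  open import Algebra.Properties.CommutativeSemigroup +-commutativeSemigroup public
    using () renaming (interchange to +-interchange)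

  module _ {A : Set} where

    ∑-cong : ∀ xs {f g : A → Carrier} → (∀ x → f x ≈ g x) → ∑ xs f ≈ ∑ xs g
    ∑-cong []       f≈g = refl
    ∑-cong (x ∷ xs) f≈g = +-cong (f≈g x) (∑-cong xs f≈g)

    ∑-mono-≤ : ∀ xs {f g : A → Carrier} → (∀ x → f x ≤ g x) → ∑ xs f ≤ ∑ xs g
    ∑-mono-≤ []       f≤g = ≤-refl
    ∑-mono-≤ (x ∷ xs) f≤g = +-mono-≤ (f≤g x) (∑-mono-≤ xs f≤g)

    ∑-nonNeg : ∀ xs {f : A → Carrier} → (∀ x → 0# ≤ f x) → 0# ≤ ∑ xs f
    ∑-nonNeg []       0≤f = ≤-refl
    ∑-nonNeg (x ∷ xs) 0≤f = ≤-trans (≤-reflexive (sym (+-identityˡ 0#))) (+-mono-≤ (0≤f x) (∑-nonNeg xs 0≤f))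

    ∑-zero : ∀ (xs : List A) → ∑[ x ← xs ] 0# ≈ 0#
    ∑-zero []       = refl
    ∑-zero (x ∷ xs) = trans (+-identityˡ _) (∑-zero xs)

    ∑-homo-+ : ∀ xs (f g : A → Carrier) → ∑[ x ← xs ] (f x + g x) ≈ ∑ xs f + ∑ xs g
    ∑-homo-+ []       f g = sym (+-identityˡ 0#)
    ∑-homo-+ (x ∷ xs) f g = trans (+-congˡ (∑-homo-+ xs f g)) (+-interchange (f x) (g x) (∑ xs f) (∑ xs g))

    ∑-distribˡ-* : ∀ xs (f : A → Carrier) c → c * ∑ xs f ≈ ∑[ x ← xs ] (c * f x)
    ∑-distribˡ-* []       f c = zeroʳ c
    ∑-distribˡ-* (x ∷ xs) f c = trans (distribˡ c (f x) (∑ xs f)) (+-congˡ (∑-distribˡ-* xs f c))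

    ∑-distribʳ-* : ∀ xs (f : A → Carrier) c → ∑ xs f * c ≈ ∑[ x ← xs ] (f x * c)
    ∑-distribʳ-* []       f c = zeroˡ c
    ∑-distribʳ-* (x ∷ xs) f c = trans (distribʳ c (f x) (∑ xs f)) (+-congˡ (∑-distribʳ-* xs f c))

    ∑-++ : ∀ xs ys (f : A → Carrier) → ∑ (xs ++ ys) f ≈ ∑ xs f + ∑ ys f
    ∑-++ []       ys f = sym (+-identityˡ _)
    ∑-++ (x ∷ xs) ys f = trans (+-congˡ (∑-++ xs ys f)) (sym (+-assoc _ _ _))

    ∑-∈ : ∀ xs {f : A → Carrier} → (∀ x → 0# ≤ f x) → ∀ {x} → x ∈ xs → f x ≤ ∑ xs f
    ∑-∈ (x ∷ xs) {f} 0≤f (here ≡.refl) = begin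
      f x            ≈⟨ +-identityʳ (f x) ⟨
      f x + 0#       ≤⟨ +-monoʳ-≤ (f x) (∑-nonNeg xs 0≤f) ⟩
      f x + ∑ xs f   ∎
    ∑-∈ (y ∷ xs) {f} 0≤f {x} (there x∈xs) = begin
      f x            ≤⟨ ∑-∈ xs 0≤f x∈xs ⟩
      ∑ xs f         ≈⟨ +-identityˡ (∑ xs f) ⟨
      0# + ∑ xs f    ≤⟨ +-mono (∑ xs f) (0≤f y) ⟩
      f y + ∑ xs f   ∎

    ∑-1 : ∀ (xs : List A) → ∑[ x ← xs ] 1# ≈ natR R (length xs)
    ∑-1 []       = refl
    ∑-1 (x ∷ xs) = +-congˡ (∑-1 xs)

    ∑-indicator : ∀ xs (b : A → Bool) →
                  ∑[ x ← xs ] (if b x then 1# else 0#) ≈ natR R (length (filter (λ x → b x Bool.≟ true) xs))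
    ∑-indicator []       b = refl
    ∑-indicator (x ∷ xs) b with b x
    ... | true  = +-congˡ (∑-indicator xs b)
    ... | false = trans (+-identityˡ _) (∑-indicator xs b)

  module _ {A B : Set} where

    ∑-map : ∀ xs (g : A → B) (f : B → Carrier) → ∑ (map g xs) f ≡ ∑[ x ← xs ] f (g x)
    ∑-map []       g f = ≡.refl
    ∑-map (x ∷ xs) g f = ≡.cong (f (g x) +_) (∑-map xs g f)

    ∑-comm : ∀ xs ys (f : A → B → Carrier) → ∑[ x ← xs ] ∑[ y ← ys ] f x y ≈ ∑[ y ← ys ] ∑[ x ← xs ] f x y
    ∑-comm []       ys f = sym (∑-zero ys)
    ∑-comm (x ∷ xs) ys f = trans (+-congˡ (∑-comm xs ys f)) (sym (∑-homo-+ ys (f x) (λ y → ∑[ x ← xs ] f x y)))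

  ∑-≤-∑-byKey : ∀ {A : Set} xs (key : A → ℕ) n {f : A → Carrier} → (∀ x → 0# ≤ f x) → (∀ x → key x ℕ.< n) →
                ∑ xs f ≤ ∑[ s ← upTo n ] ∑[ x ← xs ] (if key x ℕ.≡ᵇ s then f x else 0#)
  ∑-≤-∑-byKey xs key n {f} 0≤f key<n =
    ≤-trans (∑-mono-≤ xs termwise) (≤-reflexive (∑-comm xs (upTo n) (λ x s → if key x ℕ.≡ᵇ s then f x else 0#)))
    where
    key≡ᵇkey : ∀ k → (k ℕ.≡ᵇ k) ≡ true
    key≡ᵇkey zero    = ≡.refl
    key≡ᵇkey (suc k) = key≡ᵇkey k
    termwise : ∀ x → f x ≤ ∑[ s ← upTo n ] (if key x ℕ.≡ᵇ s then f x else 0#)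
    termwise x = ≤-trans (≤-reflexive (reflexive (≡.cong (λ b → if b then f x else 0#) (≡.sym (key≡ᵇkey (key x))))))
                   (∑-∈ (upTo n) (λ s → if-nonNeg (key x ℕ.≡ᵇ s) (0≤f x)) (∈-upTo⁺ (key<n x)))

  module PowerBalance (ℓ E : ℕ) .{{_ : NonZero ℓ}} {p x : Carrier}
                      (0≤p : 0# ≤ p) (1≤x : 1# ≤ x) (p^ℓ*x^E≈1 : p ^ ℓ * x ^ E ≈ 1#) where

    -- p behaves as x ^ (- E / ℓ), so p ^ j * x ^ e behaves as x ^ (e - E j / ℓ).
    private
      0≤x : 0# ≤ x
      0≤x = ≤-trans 0≤1 1≤x

      balance : ∀ j e → (p ^ j * x ^ e) ^ ℓ * x ^ (E ℕ.* j) ≈ x ^ (e ℕ.* ℓ)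
      balance j e = begin-equality
        (p ^ j * x ^ e) ^ ℓ * x ^ (E ℕ.* j)        ≈⟨ *-cong (^-distrib-* (p ^ j) (x ^ e) ℓ) (sym (^-assocʳ x E j)) ⟩
        (p ^ j) ^ ℓ * (x ^ e) ^ ℓ * (x ^ E) ^ j    ≈⟨ *-congʳ (*-congʳ (trans (^-assocʳ p j ℓ)
                                                       (trans (^-congʳ p (ℕ.*-comm j ℓ)) (sym (^-assocʳ p ℓ j))))) ⟩
        (p ^ ℓ) ^ j * (x ^ e) ^ ℓ * (x ^ E) ^ j    ≈⟨ *-xy∙z≈xz∙y ((p ^ ℓ) ^ j) ((x ^ e) ^ ℓ) ((x ^ E) ^ j) ⟩
        (p ^ ℓ) ^ j * (x ^ E) ^ j * (x ^ e) ^ ℓ    ≈⟨ *-congʳ (^-distrib-* (p ^ ℓ) (x ^ E) j) ⟨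
        (p ^ ℓ * x ^ E) ^ j * (x ^ e) ^ ℓ          ≈⟨ *-congʳ (trans (^-congˡ j p^ℓ*x^E≈1) (1^n≈1 j)) ⟩
        1# * (x ^ e) ^ ℓ                           ≈⟨ *-identityˡ _ ⟩
        (x ^ e) ^ ℓ                                ≈⟨ ^-assocʳ x e ℓ ⟩
        x ^ (e ℕ.* ℓ)                              ∎

      p^j*x^e-nonNeg : ∀ j e → 0# ≤ p ^ j * x ^ e
      p^j*x^e-nonNeg j e = *-nonneg (x^n-nonNeg j 0≤p) (x^n-nonNeg e 0≤x)

    p^j*x^e≤1 : ∀ j e → e ℕ.* ℓ ℕ.≤ E ℕ.* j → p ^ j * x ^ e ≤ 1#
    p^j*x^e≤1 j e eℓ≤Ej = x^n≤1⇒x≤1 ℓ (p^j*x^e-nonNeg j e) (*-cancelʳ-≤ (1≤x⇒1≤x^n (E ℕ.* j) 1≤x) (begin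
      (p ^ j * x ^ e) ^ ℓ * x ^ (E ℕ.* j) ≈⟨ balance j e ⟩
      x ^ (e ℕ.* ℓ)                       ≤⟨ ^-monoʳ-≤ 1≤x eℓ≤Ej ⟩
      x ^ (E ℕ.* j)                       ≈⟨ *-identityˡ _ ⟨
      1# * x ^ (E ℕ.* j)                  ∎))

    1≤p^j*x^e : ∀ j e → E ℕ.* j ℕ.≤ e ℕ.* ℓ → 1# ≤ p ^ j * x ^ e
    1≤p^j*x^e j e Ej≤eℓ = 1≤x^n⇒1≤x ℓ (p^j*x^e-nonNeg j e) (*-cancelʳ-≤ (1≤x⇒1≤x^n (E ℕ.* j) 1≤x) (begin
      1# * x ^ (E ℕ.* j)                  ≈⟨ *-identityˡ _ ⟩
      x ^ (E ℕ.* j)                       ≤⟨ ^-monoʳ-≤ 1≤x Ej≤eℓ ⟩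
      x ^ (e ℕ.* ℓ)                       ≈⟨ balance j e ⟨
      (p ^ j * x ^ e) ^ ℓ * x ^ (E ℕ.* j) ∎))

module RandomSubset (R : OrderedCommRing) {p : OrderedCommRing.Carrier R}
                    (0≤p : OrderedCommRing._≤ᴿ_ R (OrderedCommRing.0# R) p)
                    (p≤1 : OrderedCommRing._≤ᴿ_ R p (OrderedCommRing.1# R)) where

  open OrderedCommRing R hiding (_≤ᴿ_)
  open OrderedCommRingProperties R
  open import Relation.Binary.Reasoning.PartialOrder poset

  weight : Subset m → Carrier
  weight {m} S = p ^ size S * (1# - p) ^ (m ℕ.∸ size S)

  Pr : (Subset m → Bool) → Carrier
  Pr {m} E = ∑[ S ← allSubsets m ] (if E S then weight S else 0#)

  weight-nonNeg : (S : Subset m) → 0# ≤ weight S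
  weight-nonNeg {m} S = *-nonneg (x^n-nonNeg (size S) 0≤p) (x^n-nonNeg (m ℕ.∸ size S) (x≤y⇒0≤y-x p≤1))

  ∑-allSubsets-suc : ∀ (f : Subset (suc m) → Carrier) →
    ∑ (allSubsets (suc m)) f ≈ ∑[ S ← allSubsets m ] f (true ∷ S) + ∑[ S ← allSubsets m ] f (false ∷ S)
  ∑-allSubsets-suc {m} f = begin-equality
    ∑ (map (true ∷_) L ++ map (false ∷_) L) f    ≈⟨ ∑-++ (map (true ∷_) L) (map (false ∷_) L) f ⟩
    ∑ (map (true ∷_) L) f + ∑ (map (false ∷_) L) f ≡⟨ ≡.cong₂ _+_ (∑-map L (true ∷_) f) (∑-map L (false ∷_) f) ⟩
    ∑[ S ← L ] f (true ∷ S) + ∑[ S ← L ] f (false ∷ S) ∎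
    where
    L = allSubsets m

  weight-true∷ : (S : Subset m) → weight (true ∷ S) ≈ p * weight S
  weight-true∷ S = *-assoc p _ _

  weight-false∷ : (S : Subset m) → weight (false ∷ S) ≈ (1# - p) * weight S
  weight-false∷ {m} S = begin-equality
    p ^ size S * (1# - p) ^ (suc m ℕ.∸ size S)   ≡⟨ ≡.cong (λ n → p ^ size S * (1# - p) ^ n) (ℕ.+-∸-assoc 1 (size≤m S)) ⟩
    p ^ size S * ((1# - p) * (1# - p) ^ (m ℕ.∸ size S)) ≈⟨ *-x∙yz≈y∙xz (p ^ size S) (1# - p) _ ⟩
    (1# - p) * weight S                         ∎

  Pr-scaled : ∀ c (E : Subset m → Bool) {g : Subset m → Carrier} → (∀ S → g S ≈ c * weight S) →
              ∑[ S ← allSubsets m ] (if E S then g S else 0#) ≈ c * Pr E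
  Pr-scaled {m} c E {g} g≈cw = trans (∑-cong (allSubsets m) termwise) (sym (∑-distribˡ-* (allSubsets m) _ c))
    where
    termwise : ∀ S → (if E S then g S else 0#) ≈ c * (if E S then weight S else 0#)
    termwise S with E S
    ... | true  = g≈cw S
    ... | false = sym (zeroʳ c)

  Pr-⊇ : (A : Subset m) → Pr (A ⊆ᵇ_) ≈ p ^ size A
  Pr-⊇ {zero}  []      = trans (+-identityʳ _) (*-identityˡ 1#)
  Pr-⊇ {suc m} (a ∷ A) = trans (∑-allSubsets-suc (λ S → if (a ∷ A) ⊆ᵇ S then weight S else 0#)) (by-head a)
    where
    L = allSubsets m
    by-head : ∀ a → ∑[ S ← L ] (if (a ∷ A) ⊆ᵇ (true ∷ S) then weight (true ∷ S) else 0#)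
                    + ∑[ S ← L ] (if (a ∷ A) ⊆ᵇ (false ∷ S) then weight (false ∷ S) else 0#)
                    ≈ p ^ size (a ∷ A)
    by-head true = begin-equality
      ∑[ S ← L ] (if A ⊆ᵇ S then weight (true ∷ S) else 0#) + ∑[ S ← L ] 0#
                                       ≈⟨ +-cong (Pr-scaled p (A ⊆ᵇ_) weight-true∷) (∑-zero L) ⟩
      p * Pr (A ⊆ᵇ_) + 0#             ≈⟨ +-identityʳ _ ⟩
      p * Pr (A ⊆ᵇ_)                  ≈⟨ *-congˡ (Pr-⊇ A) ⟩
      p * p ^ size A                  ∎
    by-head false = begin-equality
      ∑[ S ← L ] (if A ⊆ᵇ S then weight (true ∷ S) else 0#)
        + ∑[ S ← L ] (if A ⊆ᵇ S then weight (false ∷ S) else 0#)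
                                       ≈⟨ +-cong (Pr-scaled p (A ⊆ᵇ_) weight-true∷) (Pr-scaled (1# - p) (A ⊆ᵇ_) weight-false∷) ⟩
      p * Pr (A ⊆ᵇ_) + (1# - p) * Pr (A ⊆ᵇ_)
                                       ≈⟨ distribʳ (Pr (A ⊆ᵇ_)) p (1# - p) ⟨
      (p + (1# - p)) * Pr (A ⊆ᵇ_)     ≈⟨ *-congʳ p+[1-p]≈1 ⟩
      1# * Pr (A ⊆ᵇ_)                 ≈⟨ *-identityˡ _ ⟩
      Pr (A ⊆ᵇ_)                      ≈⟨ Pr-⊇ A ⟩
      p ^ size A                      ∎
      where
      p+[1-p]≈1 : p + (1# - p) ≈ 1#
      p+[1-p]≈1 = trans (+-comm p (1# - p)) (trans (+-assoc 1# (- p) p)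
                    (trans (+-congˡ (-‿inverseˡ p)) (+-identityʳ 1#)))

  probUniqueCircuit≈Pr : (M : Matroid m) (C : Subset m) → probUniqueCircuit R M C p ≈ Pr (uniqueCircuitIn M C)
  probUniqueCircuit≈Pr {m} M C = ∑-cong (allSubsets m) termwise
    where
    termwise : ∀ S → (if uniqueCircuitIn M C S then powR R p (size S) * powR R (1# - p) (m ℕ.∸ size S) else 0#)
                     ≈ (if uniqueCircuitIn M C S then weight S else 0#)
    termwise S rewrite powR≡^ p (size S) | powR≡^ (1# - p) (m ℕ.∸ size S) = refl

  Pr-unionBound : (E F : Subset m → Bool) (G : Subset m → Subset m → Bool) →
                  (∀ S → E S ≡ true → F S ≡ false → Σ (Subset m) λ D → G D S ≡ true) →
                  Pr E ≤ Pr F + ∑[ D ← allSubsets m ] Pr (G D)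
  Pr-unionBound {m} E F G cover = begin
    Pr E                                                   ≤⟨ ∑-mono-≤ L termwise ⟩
    ∑[ S ← L ] ([ F S ] S + ∑[ D ← L ] [ G D S ] S)      ≈⟨ ∑-homo-+ L _ _ ⟩
    Pr F + ∑[ S ← L ] ∑[ D ← L ] [ G D S ] S              ≈⟨ +-congˡ (∑-comm L L _) ⟩
    Pr F + ∑[ D ← L ] Pr (G D)                             ∎
    where
    L = allSubsets m
    [_]_ : Bool → Subset m → Carrier
    [ b ] S = if b then weight S else 0#
    rest-nonNeg : ∀ S → 0# ≤ ∑[ D ← L ] [ G D S ] S
    rest-nonNeg S = ∑-nonNeg L (λ D → if-nonNeg (G D S) (weight-nonNeg S))
    termwise : ∀ S → [ E S ] S ≤ [ F S ] S + ∑[ D ← L ] [ G D S ] S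
    termwise S with E S in E-S | F S in F-S
    ... | false | b     = ≤-trans (rest-nonNeg S) (≤-trans (≤-reflexive (sym (+-identityˡ _)))
                            (+-mono _ (if-nonNeg b (weight-nonNeg S))))
    ... | true  | true  = ≤-trans (≤-reflexive (sym (+-identityʳ _))) (+-monoʳ-≤ (weight S) (rest-nonNeg S))
    ... | true  | false with cover S E-S F-S
    ... | D , G-D-S = begin
      weight S                    ≡⟨ ≡.cong (λ b → if b then weight S else 0#) G-D-S ⟨
      [ G D S ] S                 ≤⟨ ∑-∈ L (λ D → if-nonNeg (G D S) (weight-nonNeg S)) (∈-allSubsets D) ⟩
      ∑[ D ← L ] [ G D S ] S      ≈⟨ +-identityˡ _ ⟨
      0# + ∑[ D ← L ] [ G D S ] S ∎

module UniqueCircuit (K : ℕ) (M : Matroid m) (v : Fin m → Vec Bool d)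
                     (rep : ∀ S → Matroid.indep M S ≡ linIndep v S) (smooth : SmoothCircuitBound M K)
                     (ℓ : ℕ) .{{_ : NonZero ℓ}} (noShort : NoCircuitUpTo M ℓ)
                     (C : Subset m) (C-circ : Circuit M C) (ℓ<k : ℓ ℕ.< size C)
                     (tight : 100 ℕ.* size C ℕ.≤ 101 ℕ.* ℓ) where

  open CircuitProperties M
  open RepresentationProperties M v rep

  module _ where

    open import Data.Nat using (_+_; _*_; _^_; _/_; _≤_; _<_)

    isOtherCircuit : Subset m → Bool
    isOtherCircuit D = isCircuit M D ∧ not (D ≡ᵇ C)

    otherCircuit-excess : ∀ D → isOtherCircuit D ≡ true → size D + ℓ ≤ 7 * size (D ∖ᵇ C)
    otherCircuit-excess D D-other with ∧-true⁻ D-other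
    ... | D-circ , D≢C =
      ≡.subst (λ s → s + ℓ ≤ 7 * j) (≡.sym (size-∖ᵇ-∩ᵇ D C)) (overlap-bound ℓ i j c ℓ<|D| ℓ<|C⊕D| tight′)
      where
      i = size (D ∩ᵇ C)
      j = size (D ∖ᵇ C)
      c = size (C ∖ᵇ D)
      ℓ<|D| : ℓ < j + i
      ℓ<|D| = ≡.subst (ℓ <_) (size-∖ᵇ-∩ᵇ D C) (noCircuitUpTo⇒dependent-size> noShort D (circuit⇒dependent D-circ))
      ℓ<|C⊕D| : ℓ < c + j
      ℓ<|C⊕D| = ≡.subst (ℓ <_) (size-⊕ C D)
        (noCircuitUpTo⇒dependent-size> noShort (C ⊕ D) (circuit-⊕-dependent C-circ D-circ (not-true⁻ D≢C)))
      tight′ : 100 * (c + i) ≤ 101 * ℓ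
      tight′ = ≡.subst (λ k → 100 * k ≤ 101 * ℓ) |C|≡c+i tight
        where
        |C|≡c+i : size C ≡ c + i
        |C|≡c+i = ≡.trans (size-∖ᵇ-∩ᵇ C D) (≡.cong (λ I → c + size I) (∩ᵇ-comm C D))

    shortestCircuit : Subset m
    shortestCircuit = argmin size C (filter (λ D → isCircuit M D Bool.≟ true) (allSubsets m))

    ℓ′ : ℕ
    ℓ′ = size shortestCircuit

    shortestCircuit-circuit : Circuit M shortestCircuit
    shortestCircuit-circuit = argmin-all size C-circ (all-filter (λ D → isCircuit M D Bool.≟ true) (allSubsets m))

    minCircuitLength : MinCircuitLength M full ℓ′
    minCircuitLength = (shortestCircuit , (shortestCircuit-circuit , ⊆ᵇ-full shortestCircuit) , ≡.refl)
                     , λ D (D-circ , _) → All.lookup (f[argmin]≤f[xs] C _) (∈-filter⁺ _ (∈-allSubsets D) D-circ)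

    ℓ<ℓ′ : ℓ < ℓ′
    ℓ<ℓ′ = ℕ.≰⇒> (noShort shortestCircuit shortestCircuit-circuit)

    level : ℕ → ℕ
    level s = suc (s / ℓ)

    s≤level*ℓ′ : ∀ s → s ≤ level s * ℓ′
    s≤level*ℓ′ s = ℕ.≤-trans (ℕ.<⇒≤ (s<[1+s/ℓ]*ℓ s ℓ)) (ℕ.*-monoʳ-≤ (level s) (ℕ.<⇒≤ ℓ<ℓ′))

    circuitsUpToLevel-count : ∀ s → numCircuitsUpTo M full (level s * ℓ′) ≤ m ^ (K * level s)
    circuitsUpToLevel-count s = smooth full ℓ′ minCircuitLength (level s) (ℕ.s≤s ℕ.z≤n)

    2≤m : 2 ≤ m
    2≤m = ℕ.≤-trans (ℕ.s≤s (ℕ.>-nonZero⁻¹ ℓ)) (ℕ.≤-trans ℓ<k (size≤m C))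

    otherCircuit-counted : ∀ D s → isOtherCircuit D ≡ true → size D ≡ s →
                           (isCircuit M D ∧ (D ⊆ᵇ full) ∧ (size D ℕ.≤ᵇ level s * ℓ′)) ≡ true
    otherCircuit-counted D s D-other |D|≡s
      rewrite proj₁ (∧-true⁻ {isCircuit M D} D-other) | ⊆ᵇ-full D
      = Equivalence.to T-≡ (ℕ.≤⇒≤ᵇ (≡.subst (λ t → size D ≤ level t * ℓ′) |D|≡s (s≤level*ℓ′ (size D))))

  κ : ℕ
  κ = K ℕ.+ 3

  module Probability (R : OrderedCommRing) where

    open OrderedCommRing R hiding (_≤ᴿ_)
    open OrderedCommRingProperties R
    open import Relation.Binary.Reasoning.PartialOrder poset

    mᵣ : Carrier
    mᵣ = natR R m

    1≤mᵣ : 1# ≤ mᵣ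
    1≤mᵣ = ≤-trans (≤-reflexive (sym (+-identityʳ 1#))) (natR-mono-≤ (ℕ.≤-trans (ℕ.s≤s ℕ.z≤n) 2≤m))

    module _ {p : Carrier} (0≤p : 0# ≤ p) (p^ℓ*mᵣ^E≈1 : p ^ ℓ * mᵣ ^ (100 ℕ.* κ) ≈ 1#) where

      open PowerBalance ℓ (100 ℕ.* κ) 0≤p 1≤mᵣ p^ℓ*mᵣ^E≈1

      p≤1 : p ≤ 1#
      p≤1 = begin
        p               ≈⟨ trans (*-identityʳ (p * 1#)) (*-identityʳ p) ⟨
        p * 1# * 1#     ≤⟨ p^j*x^e≤1 1 0 ℕ.z≤n ⟩
        1#              ∎

      open RandomSubset R 0≤p p≤1

      excessWeight : Subset m → Carrier
      excessWeight D = if isOtherCircuit D then p ^ size (D ∖ᵇ C) else 0#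

      excessWeight-nonNeg : ∀ D → 0# ≤ excessWeight D
      excessWeight-nonNeg D = if-nonNeg (isOtherCircuit D) (x^n-nonNeg (size (D ∖ᵇ C)) 0≤p)

      otherCircuit-excessWeight-small : ∀ D → isOtherCircuit D ≡ true →
                            p ^ size (D ∖ᵇ C) * mᵣ ^ (3 ℕ.+ K ℕ.* level (size D)) ≤ 1#
      otherCircuit-excessWeight-small D D-other =
        p^j*x^e≤1 (size (D ∖ᵇ C)) (3 ℕ.+ K ℕ.* level (size D))
        (exponent-bound K ℓ (size D) (size (D ∖ᵇ C)) (otherCircuit-excess D D-other))

      sizeClass : ℕ → Subset m → Carrier
      sizeClass s D = if size D ℕ.≡ᵇ s then excessWeight D else 0#

      -- The circuits of size s are among the at most m^(K · level s) circuits of length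
      -- ≤ level s · ℓ′, and each has excess weight at most m^(-3 - K · level s).
      sizeClass-bound : ∀ s → ∑ (allSubsets m) (sizeClass s) * mᵣ ^ 3 ≤ 1#
      sizeClass-bound s = *-cancelʳ-≤ (1≤x⇒1≤x^n (K ℕ.* level s) 1≤mᵣ) (begin
        ∑ L (sizeClass s) * mᵣ ^ 3 * mᵣ ^ (K ℕ.* level s)
          ≈⟨ *-assoc (∑ L (sizeClass s)) (mᵣ ^ 3) (mᵣ ^ (K ℕ.* level s)) ⟩
        ∑ L (sizeClass s) * (mᵣ ^ 3 * mᵣ ^ (K ℕ.* level s))
          ≈⟨ *-congˡ (^-homo-* mᵣ 3 (K ℕ.* level s)) ⟨
        ∑ L (sizeClass s) * mᵣ ^ (3 ℕ.+ K ℕ.* level s)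
          ≈⟨ ∑-distribʳ-* L (sizeClass s) _ ⟩
        ∑[ D ← L ] (sizeClass s D * mᵣ ^ (3 ℕ.+ K ℕ.* level s))
          ≤⟨ ∑-mono-≤ L termwise ⟩
        ∑[ D ← L ] (if isCircuit M D ∧ (D ⊆ᵇ full) ∧ (size D ℕ.≤ᵇ level s ℕ.* ℓ′) then 1# else 0#)
          ≈⟨ ∑-indicator L _ ⟩
        natR R (numCircuitsUpTo M full (level s ℕ.* ℓ′))
          ≤⟨ natR-mono-≤ (circuitsUpToLevel-count s) ⟩
        natR R (m ℕ.^ (K ℕ.* level s))
          ≈⟨ natR-homo-^ m (K ℕ.* level s) ⟩
        mᵣ ^ (K ℕ.* level s)
          ≈⟨ *-identityˡ _ ⟨
        1# * mᵣ ^ (K ℕ.* level s) ∎)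
        where
        L = allSubsets m
        termwise : ∀ D → sizeClass s D * mᵣ ^ (3 ℕ.+ K ℕ.* level s) ≤
                         (if isCircuit M D ∧ (D ⊆ᵇ full) ∧ (size D ℕ.≤ᵇ level s ℕ.* ℓ′) then 1# else 0#)
        termwise D with size D ℕ.≡ᵇ s in |D|≡ᵇs | isOtherCircuit D in D-other
        ... | false | _     = ≤-trans (≤-reflexive (zeroˡ _)) (if-nonNeg _ 0≤1)
        ... | true  | false = ≤-trans (≤-reflexive (zeroˡ _)) (if-nonNeg _ 0≤1)
        ... | true  | true  with ℕ.≡ᵇ⇒≡ (size D) s (Equivalence.from T-≡ |D|≡ᵇs)
        ... | |D|≡s rewrite otherCircuit-counted D s D-other |D|≡s =
          ≡.subst (λ t → p ^ size (D ∖ᵇ C) * mᵣ ^ (3 ℕ.+ K ℕ.* level t) ≤ 1#) |D|≡s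
                  (otherCircuit-excessWeight-small D D-other)

      excessWeight-total : ∑ (allSubsets m) excessWeight * mᵣ ^ 3 ≤ natR R (suc m)
      excessWeight-total = begin
        ∑ L excessWeight * mᵣ ^ 3
          ≤⟨ *-monoʳ-≤-nonNeg (x^n-nonNeg 3 (≤-trans 0≤1 1≤mᵣ))
               (∑-≤-∑-byKey L size (suc m) excessWeight-nonNeg (λ D → ℕ.s≤s (size≤m D))) ⟩
        ∑[ s ← upTo (suc m) ] ∑ L (sizeClass s) * mᵣ ^ 3
          ≈⟨ ∑-distribʳ-* (upTo (suc m)) (λ s → ∑ L (sizeClass s)) (mᵣ ^ 3) ⟩
        ∑[ s ← upTo (suc m) ] (∑ L (sizeClass s) * mᵣ ^ 3)
          ≤⟨ ∑-mono-≤ (upTo (suc m)) sizeClass-bound ⟩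
        ∑[ s ← upTo (suc m) ] 1#
          ≈⟨ ∑-1 (upTo (suc m)) ⟩
        natR R (length (upTo (suc m)))
          ≡⟨ ≡.cong (natR R) (length-upTo (suc m)) ⟩
        natR R (suc m) ∎
        where
        L = allSubsets m

      excessWeight-bound : ∑ (allSubsets m) excessWeight + ∑ (allSubsets m) excessWeight ≤ 1#
      excessWeight-bound = *-cancelʳ-≤ (1≤x⇒1≤x^n 3 1≤mᵣ) (begin
        (T + T) * mᵣ ^ 3                   ≈⟨ distribʳ (mᵣ ^ 3) T T ⟩
        T * mᵣ ^ 3 + T * mᵣ ^ 3            ≤⟨ +-mono-≤ excessWeight-total excessWeight-total ⟩
        natR R (suc m) + natR R (suc m)    ≈⟨ natR-2*x≈x+x _ ⟨
        natR R 2 * natR R (suc m)          ≈⟨ natR-homo-* 2 (suc m) ⟨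
        natR R (2 ℕ.* suc m)               ≤⟨ natR-mono-≤ (2≤m⇒2*[1+m]≤m^3 2≤m) ⟩
        natR R (m ℕ.^ 3)                   ≈⟨ natR-homo-^ m 3 ⟩
        mᵣ ^ 3                             ≈⟨ *-identityˡ _ ⟨
        1# * mᵣ ^ 3                        ∎)
        where
        T = ∑ (allSubsets m) excessWeight

      uniqueCircuit-unionBound : p ^ size C ≤ Pr (uniqueCircuitIn M C) + p ^ size C * ∑ (allSubsets m) excessWeight
      uniqueCircuit-unionBound = begin
        p ^ size C                                 ≈⟨ Pr-⊇ C ⟨
        Pr (C ⊆ᵇ_)                                 ≤⟨ Pr-unionBound (C ⊆ᵇ_) (uniqueCircuitIn M C) pairedWith cover ⟩
        Pr (uniqueCircuitIn M C) + ∑[ D ← L ] Pr (pairedWith D)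
                                                   ≈⟨ +-congˡ (∑-cong L Pr-pairedWith) ⟩
        Pr (uniqueCircuitIn M C) + ∑[ D ← L ] (p ^ size C * excessWeight D)
                                                   ≈⟨ +-congˡ (∑-distribˡ-* L excessWeight (p ^ size C)) ⟨
        Pr (uniqueCircuitIn M C) + p ^ size C * ∑ L excessWeight ∎
        where
        L = allSubsets m
        pairedWith : Subset m → Subset m → Bool
        pairedWith D S = isOtherCircuit D ∧ ((C ∪ᵇ D) ⊆ᵇ S)
        cover : ∀ S → (C ⊆ᵇ S) ≡ true → uniqueCircuitIn M C S ≡ false → Σ (Subset m) λ D → pairedWith D S ≡ true
        cover S C⊆S C-notUnique
          with allL-false⁻ (onlyCircuitIn S) L (≡.subst (λ b → b ∧ allL (onlyCircuitIn S) L ≡ false) C⊆S C-notUnique)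
          where
          onlyCircuitIn : Subset m → Subset m → Bool
          onlyCircuitIn S D = not (isCircuit M D ∧ (D ⊆ᵇ S)) ∨ (D ≡ᵇ C)
        ... | D , D-witness with ∨-false⁻ {not (isCircuit M D ∧ (D ⊆ᵇ S))} D-witness
        ... | D-circ-in-S , D≢C with ∧-true⁻ {isCircuit M D} (not-false⁻ D-circ-in-S)
        ... | D-circ , D⊆S =
          D , ≡.cong₂ _∧_ (≡.cong₂ _∧_ D-circ (≡.cong not D≢C)) (∪ᵇ-least C D S C⊆S D⊆S)
        Pr-pairedWith : ∀ D → Pr (pairedWith D) ≈ p ^ size C * excessWeight D
        Pr-pairedWith D with isOtherCircuit D
        ... | false = trans (∑-zero L) (sym (zeroʳ _))
        ... | true  = begin-equality
          Pr ((C ∪ᵇ D) ⊆ᵇ_)                ≈⟨ Pr-⊇ (C ∪ᵇ D) ⟩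
          p ^ size (C ∪ᵇ D)                ≡⟨ ≡.cong (p ^_) (size-∪ᵇ C D) ⟩
          p ^ (size C ℕ.+ size (D ∖ᵇ C))   ≈⟨ ^-homo-* p (size C) (size (D ∖ᵇ C)) ⟩
          p ^ size C * p ^ size (D ∖ᵇ C)   ∎

      p^k≤Pr+Pr : p ^ size C ≤ Pr (uniqueCircuitIn M C) + Pr (uniqueCircuitIn M C)
      p^k≤Pr+Pr = +-cancelʳ-≤ pᵏ (begin
        pᵏ + pᵏ                    ≤⟨ +-mono-≤ uniqueCircuit-unionBound uniqueCircuit-unionBound ⟩
        (P + pᵏ * T) + (P + pᵏ * T) ≈⟨ +-interchange P (pᵏ * T) P (pᵏ * T) ⟩
        (P + P) + (pᵏ * T + pᵏ * T) ≈⟨ +-congˡ (distribˡ pᵏ T T) ⟨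
        (P + P) + pᵏ * (T + T)     ≤⟨ +-monoʳ-≤ (P + P) (*-monoˡ-≤-nonNeg (x^n-nonNeg (size C) 0≤p) excessWeight-bound) ⟩
        (P + P) + pᵏ * 1#          ≈⟨ +-congˡ (*-identityʳ pᵏ) ⟩
        (P + P) + pᵏ               ∎)
        where
        P  = Pr (uniqueCircuitIn M C)
        pᵏ = p ^ size C
        T  = ∑ (allSubsets m) excessWeight

      uniqueCircuit-likely : 1# ≤ natR R (2 ℕ.* m ℕ.^ (101 ℕ.* κ)) * probUniqueCircuit R M C p
      uniqueCircuit-likely = begin
        1#                                  ≤⟨ 1≤p^j*x^e (size C) (101 ℕ.* κ) (*-scale-≤ 100 (size C) 101 ℓ κ tight) ⟩
        p ^ size C * mᵣ ^ (101 ℕ.* κ)       ≤⟨ *-monoʳ-≤-nonNeg (x^n-nonNeg (101 ℕ.* κ) (≤-trans 0≤1 1≤mᵣ)) p^k≤Pr+Pr ⟩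
        (P + P) * mᵣ ^ (101 ℕ.* κ)          ≈⟨ *-congʳ (natR-2*x≈x+x P) ⟨
        natR R 2 * P * mᵣ ^ (101 ℕ.* κ)     ≈⟨ *-xy∙z≈xz∙y (natR R 2) P (mᵣ ^ (101 ℕ.* κ)) ⟩
        natR R 2 * mᵣ ^ (101 ℕ.* κ) * P     ≈⟨ *-congʳ (*-congˡ (natR-homo-^ m (101 ℕ.* κ))) ⟨
        natR R 2 * natR R (m ℕ.^ (101 ℕ.* κ)) * P ≈⟨ *-cong (natR-homo-* 2 (m ℕ.^ (101 ℕ.* κ))) (probUniqueCircuit≈Pr M C) ⟨
        natR R (2 ℕ.* m ℕ.^ (101 ℕ.* κ)) * probUniqueCircuit R M C p ∎
        where
        P = Pr (uniqueCircuitIn M C)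

    uniqueCircuit-probability : ∀ {p} → 0# ≤ p → powR R p ℓ * natR R (m ℕ.^ (100 ℕ.* κ)) ≈ 1# →
                                1# ≤ natR R (2 ℕ.* m ℕ.^ (101 ℕ.* κ)) * probUniqueCircuit R M C p
    uniqueCircuit-probability {p} 0≤p p^ℓ*m^E≈1 = uniqueCircuit-likely 0≤p (begin-equality
      p ^ ℓ * mᵣ ^ (100 ℕ.* κ)                  ≈⟨ *-cong (reflexive (powR≡^ p ℓ)) (natR-homo-^ m (100 ℕ.* κ)) ⟨
      powR R p ℓ * natR R (m ℕ.^ (100 ℕ.* κ))   ≈⟨ p^ℓ*m^E≈1 ⟩
      1#                                        ∎)

open import Data.Nat using (_+_; _<_; _≤_; _*_; _^_)

mainTheorem15 :
    ∀ (K : ℕ) → Σ ℕ λ κ →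
    ∀ (m : ℕ) (M : Matroid m) → RepresentableF2 M → SmoothCircuitBound M K →
    ∀ (ℓ : ℕ) → NoCircuitUpTo M ℓ →
    ∀ (C : Subset m) → Circuit M C → ℓ < size C → 100 * size C ≤ 101 * ℓ →
    ∀ (R : OrderedCommRing) (p : OrderedCommRing.Carrier R) →
    OrderedCommRing._≤ᴿ_ R (OrderedCommRing.0# R) p →
    OrderedCommRing._≈_ R
      (OrderedCommRing._*_ R (powR R p ℓ) (natR R (m ^ (100 * κ))))
      (OrderedCommRing.1# R) →
    OrderedCommRing._≤ᴿ_ R (OrderedCommRing.1# R)
      (OrderedCommRing._*_ R (natR R (2 * m ^ (101 * κ)))
        (probUniqueCircuit R M C p))
mainTheorem15 K = K + 3 ,
  λ m M (_ , v , rep) smooth ℓ noShort C C-circ ℓ<k tight R p 0≤p p^ℓ*m^E≈1 →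
    UniqueCircuit.Probability.uniqueCircuit-probability
      K M v rep smooth ℓ {{ℓ<k∧100k≤101ℓ⇒NonZero ℓ<k tight}} noShort C C-circ ℓ<k tight R 0≤p p^ℓ*m^E≈1
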